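{- For every $\varepsilon>0$ there exist a prime $p_\varepsilon$ and a function $f$ on primes with $f(p)\le 1/2$ and $f(p)\to0$ as $p\to\infty$, such that for all primes $p\ge p_\varepsilon$, all integers $N\ge1$ and all $\alpha\in\mathscr B(p,N)$ with $\mathfrak d_{p,N}(\alpha,O)\ge f(p)$ (where $O=0$ is the origin), \[ \frac{1}{\#\mathcal V(p,N)}\#\big\{\beta\in\mathcal V(p,N): |\cos(\widehat{\alpha O\beta})|\le\varepsilon\big\}\ \ge\ 1-\varepsilon . \]
   Context: Let $p$ be an odd prime, $\omega=\exp(2\pi i/p)$, and $\mathbb{Q}(\omega)$ the $p$-th cyclotomic field, with $\mathbb{Q}$-basis $\omega,\dots,\omega^{p-1}$. For $\gamma\in\mathbb{Q}(\omega)$, $\mathrm{Tr}(\gamma)=\sum_{\sigma\in\mathrm{Gal}(\mathbb{Q}(\omega)/\mathbb{Q})}\sigma(\gamma)$. Let $\psi(\gamma)=(\mathrm{Tr}(\gamma\omega),\dots,\mathrm{Tr}(\gamma\omega^{p-1}))\in\mathbb{Q}^{p-1}$, $\|\gamma\|$ the Euclidean norm of $\psi(\gamma)$, $d(\alpha,\beta)=\|\beta-\alpha\|$, and $\mathfrak d_{p,N}(\alpha,\beta)=d(\alpha,\beta)/(2Np(p-1)^{1/2})$. For an integer $N\ge1$, $\mathscr B(p,N)=\{\sum_{j=1}^{p-1}a_j\omega^j: a_j\in[-N,N]\cap\mathbb{Z}\}$ and $\mathcal V(p,N)=\{\sum_{j=1}^{p-1}a_j\omega^j: a_j\in\{ -N,N\}\}$.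 The angle $\widehat{\alpha O\beta}$ is the angle at $O$ in this metric (equivalently the Euclidean angle between $\psi(\alpha)$ and $\psi(\beta)$), so $\cos(\widehat{\alpha O\beta})=\dfrac{\mathfrak d_{p,N}(O,\alpha)^2+\mathfrak d_{p,N}(O,\beta)^2-\mathfrak d_{p,N}(\alpha,\beta)^2}{2\,\mathfrak d_{p,N}(O,\alpha)\,\mathfrak d_{p,N}(O,\beta)}$.
   Formalization: The parameter ε ranges only over the positive rationals, and the function f on primes is taken with rational values. -}

module Defs where

open import Data.Nat as ℕ using (ℕ; zero; suc; _∸_; _^_)
open import Data.Integer as ℤ using (ℤ; +_; -_; _≤_)
open import Data.Rational as ℚ using (ℚ; _/_)
open import Data.Rational.Properties using (_≤?_)
open import Data.Bool using (Bool; true; false)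
open import Data.Vec using (Vec; []; _∷_; map; zipWith; foldr; iterate; init; last)
open import Data.List as L using (List; length; filter)
open import Data.Vec.Relation.Unary.All using (All)
open import Relation.Nullary using (Dec)

-- An element  Σ_{j=1}^{p-1} c_j ω^j  of ℤ[ω] ⊆ ℚ(ω) is represented by its
-- coordinate vector (c_1 , … , c_{p-1}) : Vec ℤ (p ∸ 1) in the basis ω,…,ω^{p-1}.
Cyc : ℕ → Set
Cyc p = Vec ℤ (p ∸ 1)

-- multiplication by ω in these coordinates:
-- ω · ω^j = ω^{j+1} (1 ≤ j ≤ p-2) and ω · ω^{p-1} = 1 = -(ω + … + ω^{p-1}).
mulω : ∀ {n} → Vec ℤ n → Vec ℤ n
mulω []       = []
mulω (x ∷ xs) = map (λ y → y ℤ.- l) (+ 0 ∷ init (x ∷ xs))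
  where l = last (x ∷ xs)

-- trace Tr : ℚ(ω) → ℚ on these coordinates, using Tr(ω^j) = -1 for 1 ≤ j ≤ p-1
-- (p prime: the Galois conjugates of ω^j are all the primitive p-th roots of unity).
sumℤ : ∀ {n} → Vec ℤ n → ℤ
sumℤ = foldr _ ℤ._+_ (+ 0)

Tr : ∀ {n} → Vec ℤ n → ℤ
Tr c = - sumℤ c

ψ : ∀ {n} → Vec ℤ n → Vec ℤ n
ψ {n} c = map Tr (iterate mulω (mulω c) n)

dot : ∀ {n} → Vec ℤ n → Vec ℤ n → ℤ
dot u v = sumℤ (zipWith ℤ._*_ u v)

normSq : ∀ {n} → Vec ℤ n → ℤ
normSq c = dot (ψ c) (ψ c)

toℚ : ℤ → ℚ
toℚ z = z / 1

-- α ∈ 𝓑(p,N): all coordinates in [-N, N]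
InBox : (p N : ℕ) → Cyc p → Set
InBox p N a = All (λ x → - (+ N) ≤ x × x ≤ + N) a
  where open import Data.Product using (_×_)

-- all sign vectors of length n (these parametrise 𝓥(p,N) bijectively, n = p-1)
allSigns : (n : ℕ) → List (Vec Bool n)
allSigns zero    = L.[ [] ]
allSigns (suc n) = L.map (true ∷_) (allSigns n) L.++ L.map (false ∷_) (allSigns n)

signed : ∀ {n} → ℕ → Vec Bool n → Vec ℤ n
signed N = map (λ { true → + N ; false → - (+ N) })

-- |cos(∠ αOβ)| ≤ ε, written without square roots:
-- ⟨ψα,ψβ⟩² ≤ ε² ‖α‖² ‖β‖²
CosSmall : ∀ {n} → ℚ → Vec ℤ n → Vec ℤ n → Set
CosSmall ε α β =
  toℚ (dot (ψ α) (ψ β)) ℚ.* toℚ (dot (ψ α) (ψ β))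
    ℚ.≤ (ε ℚ.* ε) ℚ.* (toℚ (normSq α) ℚ.* toℚ (normSq β))

cosSmall? : ∀ {n} (ε : ℚ) (α β : Vec ℤ n) → Dec (CosSmall ε α β)
cosSmall? ε α β = _ ≤? _

goodCount : (p N : ℕ) → ℚ → Cyc p → ℕ
goodCount p N ε α =
  length (filter (λ s → cosSmall? ε α (signed N s)) (allSigns (p ∸ 1)))

cardV : ℕ → ℕ
cardV p = length (allSigns (p ∸ 1))

-- 𝔡_{p,N}(α,O) ≥ f, for f > 0, squared:  ‖α‖² ≥ f² · 4 N² p² (p-1)
DistGe : (p N : ℕ) → ℚ → Cyc p → Set
DistGe p N f α =
  (f ℚ.* f) ℚ.* toℚ (+ (4 ℕ.* (N ℕ.* N) ℕ.* (p ℕ.* p) ℕ.* (p ∸ 1))) ℚ.≤ toℚ (normSq α)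

-- Work with the n = p − 1 coordinates, |·| the Euclidean norm of a coordinate vector and ‖·‖
-- as in the statement. Let ψ′ v = p·v − (Σ v)·𝟙. Then ψ is ψ′ followed by reversing the
-- coordinates (multiplication by ω rotates the coefficients of 1, ω, …, ω^n), and ψ′ is
-- self-adjoint, so ⟨ψα, ψβ⟩ = ⟨β, z⟩ with z = ψ′(ψ′α), |z|² ≤ p²‖α‖², and for a sign vector
-- β ∈ 𝒱(p,N) one has ‖β‖² = p²·nN² − (p+1)(Σβ)². Summed over the 2ⁿ sign vectors, ⟨β,u⟩²
-- totals 2ⁿN²|u|², so by Markov's inequality with K = 2m (m the denominator of ε) at most
-- 2ⁿ/K sign vectors have ⟨β,z⟩² > K N²|z|², and at most 2ⁿ/K have (Σβ)² > K N² n. For all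
-- other β, cos² ≤ K p² / (n(p² − (p+1)K)) ≤ 1/m² ≤ ε² as soon as n ≥ 2m³ + 2m, so at least a
-- fraction 1 − 1/m ≥ 1 − ε of 𝒱(p,N) is good. This holds for every α; p_ε is a prime above
-- 2m³ + 2m (Euclid) and f(p) = 1/(p+2).

module Submission where

open import Defs
open import Data.Nat as ℕ using (ℕ)
open import Data.Nat.Primality using (Prime)
open import Data.Integer using (+_)
open import Data.Rational as ℚ using (ℚ; 0ℚ; 1ℚ; _/_; ∣_∣)
open import Data.Product using (Σ; ∃; _×_)

open import Data.Bool using (Bool; true; false)
open import Data.Empty using (⊥-elim)
open import Data.Integer as ℤ using (ℤ; -_; _+_; _-_; _*_; _≤_; _<_; +[1+_])
import Data.Integer.Properties as ℤₚ
open import Data.Integer.Tactic.RingSolver using (solve-∀)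
open import Data.List as L using (List; length; filter)
import Data.List.Properties as Lₚ
open import Data.List.Relation.Unary.All as All using ()
open import Data.Nat using (zero; suc; _∸_; _^_; _!)
open import Data.Nat.Coprimality using (1-coprimeTo)
open import Data.Nat.Divisibility using (_∣_; m∣m*n; ∣m+n∣m⇒∣n; ∣1⇒≡1; ∣-trans; m≤n⇒m!∣n!)
open import Data.Nat.Primality using (¬prime[1]; prime⇒nonZero)
open import Data.Nat.Primality.Factorisation using (factorise)
import Data.Nat.Properties as ℕₚ
open import Data.Nat.Tactic.RingSolver using () renaming (solve-∀ to ℕ-solve-∀)
open import Data.Product using (_,_; proj₁; proj₂)
open import Data.Rational using (mkℚ; toℚᵘ)
import Data.Rational.Properties as ℚₚ
open import Data.Rational.Unnormalised as ℚᵘ using (ℚᵘ; mkℚᵘ; *≤*) renaming (_≃_ to _≃ᵘ_)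
import Data.Rational.Unnormalised.Properties as ℚᵘₚ
open import Data.Vec as V using (Vec; []; _∷_; map; iterate; init; last; head; reverse; toList; _∷ʳ_)
import Data.Vec.Properties as Vₚ
open import Function using (_∘_)
open import Level using (0ℓ)
open import Relation.Binary.PropositionalEquality
open import Relation.Nullary using (¬_; yes; no; does)
open import Relation.Unary using (Pred; Decidable)

private
  variable
    A B : Set
    n : ℕ

init-map : (f : A → B) (xs : Vec A (suc n)) → init (map f xs) ≡ map f (init xs)
init-map f (x ∷ [])     = refl
init-map f (x ∷ y ∷ ys) = cong (f x ∷_) (init-map f (y ∷ ys))

last-map : (f : A → B) (xs : Vec A (suc n)) → last (map f xs) ≡ f (last xs)
last-map f (x ∷ [])     = refl
last-map f (x ∷ y ∷ ys) = last-map f (y ∷ ys)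

iterate-map : ∀ {f : B → B} {g : A → B} {h : A → A} → (∀ x → f (g x) ≡ g (h x)) →
              ∀ x k → iterate f (g x) k ≡ map g (iterate h x k)
iterate-map comm x zero = refl
iterate-map {f = f} {g} {h} comm x (suc k) =
  cong (g x ∷_) (trans (cong (λ y → iterate f y k) (comm x)) (iterate-map comm (h x) k))

rotate : Vec A (suc n) → Vec A (suc n)
rotate w = last w ∷ init w

rotateₗ : List A → List A
rotateₗ xs = moveHead (L.reverse xs)
  where
  moveHead : List A → List A
  moveHead L.[]       = L.[]
  moveHead (y L.∷ ys) = y L.∷ L.reverse ys

rotateₗ-∷ʳ : ∀ (xs : List A) y → rotateₗ (xs L.∷ʳ y) ≡ y L.∷ xs
rotateₗ-∷ʳ xs y rewrite Lₚ.reverse-++ xs L.[ y ] = cong (y L.∷_) (Lₚ.reverse-involutive xs)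

toList-rotate : (w : Vec A (suc n)) → toList (rotate w) ≡ rotateₗ (toList w)
toList-rotate w = sym (begin
  rotateₗ (toList w)                        ≡⟨ cong (rotateₗ ∘ toList) (proj₂ (proj₂ (V.initLast w))) ⟩
  rotateₗ (toList (init w ∷ʳ last w))       ≡⟨ cong rotateₗ (Vₚ.toList-∷ʳ (last w) (init w)) ⟩
  rotateₗ (toList (init w) L.∷ʳ last w)     ≡⟨ rotateₗ-∷ʳ (toList (init w)) (last w) ⟩
  toList (rotate w)                         ∎)
  where open ≡-Reasoning

rotationHeads : Vec A (suc n) → (k : ℕ) → Vec A k
rotationHeads w k = map head (iterate rotate w k)

rotationHeadsₗ : List A → ℕ → List A
rotationHeadsₗ _            zero    = L.[]
rotationHeadsₗ L.[]         (suc k) = L.[]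
rotationHeadsₗ (x L.∷ xs)   (suc k) = x L.∷ rotationHeadsₗ (rotateₗ (x L.∷ xs)) k

rotationHeadsₗ-++-reverse : ∀ (u r : List A) → rotationHeadsₗ (rotateₗ (u L.++ L.reverse r)) (length r) ≡ r
rotationHeadsₗ-++-reverse u L.[]        = refl
rotationHeadsₗ-++-reverse u (y L.∷ r)
  rewrite Lₚ.unfold-reverse y r | sym (Lₚ.++-assoc u (L.reverse r) L.[ y ]) | rotateₗ-∷ʳ (u L.++ L.reverse r) y
  = cong (y L.∷_) (rotationHeadsₗ-++-reverse (y L.∷ u) r)

toList-rotationHeads : (w : Vec A (suc n)) (k : ℕ) → toList (rotationHeads w k) ≡ rotationHeadsₗ (toList w) k
toList-rotationHeads w         zero    = refl
toList-rotationHeads (x ∷ xs) (suc k) =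
  cong (x L.∷_) (trans (toList-rotationHeads (rotate (x ∷ xs)) k) (cong (λ l → rotationHeadsₗ l k) (toList-rotate (x ∷ xs))))

rotationHeads-rotate : ∀ x (c : Vec A n) → rotationHeads (rotate (x ∷ c)) n ≡ reverse c
rotationHeads-rotate {n = n} x c = trans (sym (Vₚ.cast-is-id refl _)) (Vₚ.toList-injective refl _ _ (begin
  toList (rotationHeads (rotate (x ∷ c)) n)               ≡⟨ toList-rotationHeads (rotate (x ∷ c)) n ⟩
  rotationHeadsₗ (toList (rotate (x ∷ c))) n              ≡⟨ cong (λ l → rotationHeadsₗ l n) (toList-rotate (x ∷ c)) ⟩
  rotationHeadsₗ (rotateₗ (x L.∷ toList c)) n             ≡⟨ cong₂ (λ l k → rotationHeadsₗ (rotateₗ (x L.∷ l)) k)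
                                                                   (sym (Lₚ.reverse-involutive (toList c))) length-r ⟩
  rotationHeadsₗ (rotateₗ (L.[ x ] L.++ L.reverse r)) (length r) ≡⟨ rotationHeadsₗ-++-reverse L.[ x ] r ⟩
  r                                                       ≡⟨ Vₚ.toList-reverse c ⟨
  toList (reverse c)                                      ∎))
  where
  open ≡-Reasoning
  r = L.reverse (toList c)
  length-r : n ≡ length r
  length-r = sym (trans (Lₚ.length-reverse (toList c)) (Vₚ.length-toList c))

-- w : Vec ℤ (suc n) stands for Σ_{j ≤ n} w_j ω^j (p = n + 1), on which multiplication by ω is
-- rotate; reduce w rewrites it in the basis ω, …, ω^n of Cyc using 1 = −(ω + ⋯ + ω^n).
reduce : Vec ℤ (suc n) → Vec ℤ n
reduce (w₀ ∷ ws) = map (_- w₀) ws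

reduce-0∷ : (c : Vec ℤ n) → reduce (+ 0 ∷ c) ≡ c
reduce-0∷ c = trans (Vₚ.map-cong ℤₚ.+-identityʳ c) (Vₚ.map-id c)

mulω-reduce : (w : Vec ℤ (suc n)) → mulω (reduce w) ≡ reduce (rotate w)
mulω-reduce (w₀ ∷ [])           = refl
mulω-reduce (w₀ ∷ ws@(_ ∷ _)) = begin
  mulω (map (_- w₀) ws)
    ≡⟨ cong₂ (λ l v → map (_- l) (+ 0 ∷ v)) (last-map (_- w₀) ws) (init-map (_- w₀) ws) ⟩
  map (_- (last ws - w₀)) (+ 0 ∷ map (_- w₀) (init ws))
    ≡⟨ cong (+ 0 - (last ws - w₀) ∷_) (Vₚ.map-∘ (_- (last ws - w₀)) (_- w₀) (init ws)) ⟨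
  (+ 0 - (last ws - w₀)) ∷ map ((_- (last ws - w₀)) ∘ (_- w₀)) (init ws)
    ≡⟨ cong (_∷ map ((_- (last ws - w₀)) ∘ (_- w₀)) (init ws)) (rebase-head w₀ (last ws)) ⟩
  (w₀ - last ws) ∷ map ((_- (last ws - w₀)) ∘ (_- w₀)) (init ws)
    ≡⟨ cong (w₀ - last ws ∷_) (Vₚ.map-cong (λ x → rebase x w₀ (last ws)) (init ws)) ⟩
  reduce (rotate (w₀ ∷ ws))
    ∎
  where
  open ≡-Reasoning
  rebase-head : ∀ w₀ l → + 0 - (l - w₀) ≡ w₀ - l
  rebase-head = solve-∀
  rebase : ∀ x w₀ l → x - w₀ - (l - w₀) ≡ x - l
  rebase = solve-∀

sum-rotate : (w : Vec ℤ (suc n)) → sumℤ (rotate w) ≡ sumℤ w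
sum-rotate (x ∷ [])     = refl
sum-rotate (x ∷ y ∷ ys) = trans (swap (last (y ∷ ys)) x _) (cong (_+_ x) (sum-rotate (y ∷ ys)))
  where
  swap : ∀ a b c → a + (b + c) ≡ b + (a + c)
  swap = solve-∀

sum-map-affine : ∀ a b (v : Vec ℤ n) → sumℤ (map (λ x → a * x - b) v) ≡ a * sumℤ v - + n * b
sum-map-affine a b []            = base a b
  where
  base : ∀ a b → + 0 ≡ a * + 0 - + 0 * b
  base = solve-∀
sum-map-affine {suc n} a b (x ∷ v) rewrite sum-map-affine a b v | ℤₚ.pos-+ 1 n = step a b x (sumℤ v) (+ n)
  where
  step : ∀ a b x s n → a * x - b + (a * s - n * b) ≡ a * (x + s) - (+ 1 + n) * b
  step = solve-∀

dot-map-affine : ∀ a b (u v : Vec ℤ n) → dot (map (λ x → a * x - b) u) v ≡ a * dot u v - b * sumℤ v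
dot-map-affine a b []      []      = base a b
  where
  base : ∀ a b → + 0 ≡ a * + 0 - b * + 0
  base = solve-∀
dot-map-affine a b (x ∷ u) (y ∷ v) rewrite dot-map-affine a b u v = step a b x y (dot u v) (sumℤ v)
  where
  step : ∀ a b x y d s → (a * x - b) * y + (a * d - b * s) ≡ a * (x * y + d) - b * (y + s)
  step = solve-∀

Tr-reduce : (w : Vec ℤ (suc n)) → Tr (reduce w) ≡ + suc n * head w - sumℤ w
Tr-reduce {n} (w₀ ∷ ws) = begin
  - sumℤ (map (_- w₀) ws)                 ≡⟨ cong (-_ ∘ sumℤ) (Vₚ.map-cong (λ x → cong (_- w₀) (sym (ℤₚ.*-identityˡ x))) ws) ⟩
  - sumℤ (map (λ x → + 1 * x - w₀) ws)     ≡⟨ cong -_ (sum-map-affine (+ 1) w₀ ws) ⟩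
  - (+ 1 * sumℤ ws - + n * w₀)             ≡⟨ trace-identity w₀ (sumℤ ws) (+ n) ⟩
  (+ 1 + + n) * w₀ - (w₀ + sumℤ ws)        ≡⟨ cong (λ m → m * w₀ - (w₀ + sumℤ ws)) (ℤₚ.pos-+ 1 n) ⟨
  + suc n * w₀ - (w₀ + sumℤ ws)            ∎
  where
  open ≡-Reasoning
  trace-identity : ∀ w₀ s n → - (+ 1 * s - n * w₀) ≡ (+ 1 + n) * w₀ - (w₀ + s)
  trace-identity = solve-∀

Tr-reduce-rotations : ∀ k (w : Vec ℤ (suc n)) →
  map (Tr ∘ reduce) (iterate rotate w k) ≡ map (λ h → + suc n * h - sumℤ w) (rotationHeads w k)
Tr-reduce-rotations zero    w = refl
Tr-reduce-rotations {n} (suc k) w = cong₂ _∷_ (Tr-reduce w) (begin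
  map (Tr ∘ reduce) (iterate rotate (rotate w) k)
    ≡⟨ Tr-reduce-rotations k (rotate w) ⟩
  map (λ h → + suc n * h - sumℤ (rotate w)) (rotationHeads (rotate w) k)
    ≡⟨ cong (λ s → map (λ h → + suc n * h - s) (rotationHeads (rotate w) k)) (sum-rotate w) ⟩
  map (λ h → + suc n * h - sumℤ w) (rotationHeads (rotate w) k)
    ∎)
  where open ≡-Reasoning

ψ′ : Vec ℤ n → Vec ℤ n
ψ′ {n} v = map (λ x → + suc n * x - sumℤ v) v

ψ≡reverse∘ψ′ : (c : Vec ℤ n) → ψ c ≡ reverse (ψ′ c)
ψ≡reverse∘ψ′ {n} c = begin
  map Tr (iterate mulω (mulω c) n)                    ≡⟨ cong (λ d → map Tr (iterate mulω (mulω d) n)) (reduce-0∷ c) ⟨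
  map Tr (iterate mulω (mulω (reduce w)) n)           ≡⟨ cong (λ d → map Tr (iterate mulω d n)) (mulω-reduce w) ⟩
  map Tr (iterate mulω (reduce (rotate w)) n)         ≡⟨ cong (map Tr) (iterate-map mulω-reduce (rotate w) n) ⟩
  map Tr (map reduce (iterate rotate (rotate w) n))   ≡⟨ Vₚ.map-∘ Tr reduce _ ⟨
  map (Tr ∘ reduce) (iterate rotate (rotate w) n)     ≡⟨ Tr-reduce-rotations n (rotate w) ⟩
  map (λ h → + suc n * h - sumℤ (rotate w)) (rotationHeads (rotate w) n)
    ≡⟨ cong₂ (λ s hs → map (λ h → + suc n * h - s) hs) (trans (sum-rotate w) (ℤₚ.+-identityˡ (sumℤ c))) (rotationHeads-rotate (+ 0) c) ⟩
  map (λ h → + suc n * h - sumℤ c) (reverse c)        ≡⟨ Vₚ.map-reverse _ c ⟩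
  reverse (ψ′ c)                                      ∎
  where
  open ≡-Reasoning
  w = + 0 ∷ c

dot-comm : (u v : Vec ℤ n) → dot u v ≡ dot v u
dot-comm []      []      = refl
dot-comm (x ∷ u) (y ∷ v) = cong₂ _+_ (ℤₚ.*-comm x y) (dot-comm u v)

dot-∷ʳ : (u v : Vec ℤ n) (x y : ℤ) → dot (u ∷ʳ x) (v ∷ʳ y) ≡ dot u v + x * y
dot-∷ʳ []      []      x y = ℤₚ.+-comm (x * y) (+ 0)
dot-∷ʳ (a ∷ u) (b ∷ v) x y = trans (cong (_+_ (a * b)) (dot-∷ʳ u v x y)) (sym (ℤₚ.+-assoc (a * b) (dot u v) (x * y)))

dot-reverse : (u v : Vec ℤ n) → dot (reverse u) (reverse v) ≡ dot u v
dot-reverse []      []      = refl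
dot-reverse (x ∷ u) (y ∷ v) rewrite Vₚ.reverse-∷ x u | Vₚ.reverse-∷ y v | dot-∷ʳ (reverse u) (reverse v) x y | dot-reverse u v =
  ℤₚ.+-comm (dot u v) (x * y)

dot-ψ : (a b : Vec ℤ n) → dot (ψ a) (ψ b) ≡ dot (ψ′ a) (ψ′ b)
dot-ψ a b rewrite ψ≡reverse∘ψ′ a | ψ≡reverse∘ψ′ b = dot-reverse (ψ′ a) (ψ′ b)

dot-ψ′ˡ : (u v : Vec ℤ n) → dot (ψ′ u) v ≡ + suc n * dot u v - sumℤ u * sumℤ v
dot-ψ′ˡ {n} u v = dot-map-affine (+ suc n) (sumℤ u) u v

ψ′-selfAdjoint : (u v : Vec ℤ n) → dot (ψ′ u) v ≡ dot u (ψ′ v)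
ψ′-selfAdjoint {n} u v = begin
  dot (ψ′ u) v                           ≡⟨ dot-ψ′ˡ u v ⟩
  + suc n * dot u v - sumℤ u * sumℤ v    ≡⟨ cong₂ (λ d s → + suc n * d - s) (dot-comm u v) (ℤₚ.*-comm (sumℤ u) (sumℤ v)) ⟩
  + suc n * dot v u - sumℤ v * sumℤ u    ≡⟨ dot-ψ′ˡ v u ⟨
  dot (ψ′ v) u                           ≡⟨ dot-comm (ψ′ v) u ⟩
  dot u (ψ′ v)                           ∎
  where open ≡-Reasoning

sum-ψ′ : (v : Vec ℤ n) → sumℤ (ψ′ v) ≡ sumℤ v
sum-ψ′ {n} v = trans (sum-map-affine (+ suc n) (sumℤ v) v) (trans (cong (λ p → p * sumℤ v - + n * sumℤ v) (ℤₚ.pos-+ 1 n)) (cancel (sumℤ v) (+ n)))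
  where
  cancel : ∀ s n → (+ 1 + n) * s - n * s ≡ s
  cancel = solve-∀

dot-ψ′-ψ′ : (v : Vec ℤ n) → dot (ψ′ v) (ψ′ v) ≡ + suc n * + suc n * dot v v - (+ suc n + + 1) * (sumℤ v * sumℤ v)
dot-ψ′-ψ′ {n} v = begin
  dot (ψ′ v) (ψ′ v)                                    ≡⟨ dot-ψ′ˡ v (ψ′ v) ⟩
  P * dot v (ψ′ v) - sumℤ v * sumℤ (ψ′ v)              ≡⟨ cong₂ (λ d s → P * d - sumℤ v * s) (ψ′-selfAdjoint v v) (sym (sum-ψ′ v)) ⟨
  P * dot (ψ′ v) v - sumℤ v * sumℤ v                   ≡⟨ cong (λ d → P * d - sumℤ v * sumℤ v) (dot-ψ′ˡ v v) ⟩
  P * (P * dot v v - sumℤ v * sumℤ v) - sumℤ v * sumℤ v ≡⟨ expand P (dot v v) (sumℤ v) ⟩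
  P * P * dot v v - (P + + 1) * (sumℤ v * sumℤ v)      ∎
  where
  open ≡-Reasoning
  P = + suc n
  expand : ∀ P d s → P * (P * d - s * s) - s * s ≡ P * P * d - (P + + 1) * (s * s)
  expand = solve-∀

0≤* : ∀ {a b} → + 0 ≤ a → + 0 ≤ b → + 0 ≤ a * b
0≤* {a} {b} 0≤a 0≤b = subst (_≤ a * b) (ℤₚ.*-zeroˡ b) (ℤₚ.*-monoʳ-≤-nonNeg b {{ℤ.nonNegative 0≤b}} 0≤a)

0≤x*x : ∀ x → + 0 ≤ x * x
0≤x*x (+ n)      = subst (+ 0 ≤_) (ℤₚ.pos-* n n) (ℤ.+≤+ ℕ.z≤n)
0≤x*x ℤ.-[1+ n ] = ℤ.+≤+ ℕ.z≤n

0≤dot-self : (v : Vec ℤ n) → + 0 ≤ dot v v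
0≤dot-self []      = ℤₚ.≤-refl
0≤dot-self (x ∷ v) = ℤₚ.+-mono-≤ (0≤x*x x) (0≤dot-self v)

*-monoˡ-≤-nonNeg′ : ∀ {a x y} → + 0 ≤ a → x ≤ y → a * x ≤ a * y
*-monoˡ-≤-nonNeg′ {a} 0≤a = ℤₚ.*-monoˡ-≤-nonNeg a {{ℤ.nonNegative 0≤a}}

i≤k*i : ∀ {k i} → + 1 ≤ k → + 0 ≤ i → i ≤ k * i
i≤k*i {k} {i} 1≤k 0≤i = ℤₚ.≤-trans (ℤₚ.≤-reflexive (sym (ℤₚ.*-identityˡ i))) (ℤₚ.*-monoʳ-≤-nonNeg i {{ℤ.nonNegative 0≤i}} 1≤k)

𝟙 : ∀ n → Vec ℤ n
𝟙 n = V.replicate n (+ 1)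

sumℤ≡dot-𝟙 : (v : Vec ℤ n) → sumℤ v ≡ dot v (𝟙 n)
sumℤ≡dot-𝟙 []      = refl
sumℤ≡dot-𝟙 (x ∷ v) = cong₂ _+_ (sym (ℤₚ.*-identityʳ x)) (sumℤ≡dot-𝟙 v)

dot-𝟙-𝟙 : ∀ n → dot (𝟙 n) (𝟙 n) ≡ + n
dot-𝟙-𝟙 zero    = refl
dot-𝟙-𝟙 (suc n) = trans (cong (_+_ (+ 1)) (dot-𝟙-𝟙 n)) (sym (ℤₚ.pos-+ 1 n))

dot-signed-self : ∀ N (s : Vec Bool n) → dot (signed N s) (signed N s) ≡ + n * (+ N * + N)
dot-signed-self N []              = sym (ℤₚ.*-zeroˡ (+ N * + N))
dot-signed-self {suc n} N (b ∷ s) =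
  trans (cong₂ _+_ (entry² b) (dot-signed-self N s)) (trans (collect (+ N * + N) (+ n)) (cong (_* (+ N * + N)) (sym (ℤₚ.pos-+ 1 n))))
  where
  entry² : ∀ b → V.head (signed N (b ∷ [])) * V.head (signed N (b ∷ [])) ≡ + N * + N
  entry² true  = refl
  entry² false = neg-square (+ N)
    where
    neg-square : ∀ x → - x * - x ≡ x * x
    neg-square = solve-∀
  collect : ∀ a n → a + n * a ≡ (+ 1 + n) * a
  collect = solve-∀

normSq-signed : ∀ N (s : Vec Bool n) → let β = signed N s ; P = + suc n in
  normSq β ≡ P * P * (+ n * (+ N * + N)) - (P + + 1) * (dot β (𝟙 n) * dot β (𝟙 n))
normSq-signed {n} N s = begin
  dot (ψ β) (ψ β)                                                        ≡⟨ dot-ψ β β ⟩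
  dot (ψ′ β) (ψ′ β)                                                      ≡⟨ dot-ψ′-ψ′ β ⟩
  P * P * dot β β - (P + + 1) * (sumℤ β * sumℤ β)                        ≡⟨ cong₂ (λ d s → P * P * d - (P + + 1) * (s * s)) (dot-signed-self N s) (sumℤ≡dot-𝟙 β) ⟩
  P * P * (+ n * (+ N * + N)) - (P + + 1) * (dot β (𝟙 n) * dot β (𝟙 n))  ∎
  where
  open ≡-Reasoning
  β = signed N s
  P = + suc n

dot-ψ-ψ : (α β : Vec ℤ n) → dot (ψ α) (ψ β) ≡ dot β (ψ′ (ψ′ α))
dot-ψ-ψ α β = trans (dot-ψ α β) (trans (sym (ψ′-selfAdjoint (ψ′ α) β)) (dot-comm (ψ′ (ψ′ α)) β))

dot-ψ′-ψ′≤ : (v : Vec ℤ n) → dot (ψ′ v) (ψ′ v) ≤ + suc n * + suc n * dot v v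
dot-ψ′-ψ′≤ {n} v = subst (_≤ P * P * dot v v) (sym (dot-ψ′-ψ′ v))
  (ℤₚ.i≤j⇒i-k≤j ((P + + 1) * (sumℤ v * sumℤ v)) {{ℤ.nonNegative (0≤* {P + + 1} (ℤ.+≤+ ℕ.z≤n) (0≤x*x (sumℤ v)))}} ℤₚ.≤-refl)
  where
  P = + suc n

sumMap : (A → ℤ) → List A → ℤ
sumMap f L.[]       = + 0
sumMap f (x L.∷ xs) = f x + sumMap f xs

sumMap-++ : ∀ (f : A → ℤ) xs ys → sumMap f (xs L.++ ys) ≡ sumMap f xs + sumMap f ys
sumMap-++ f L.[]       ys = sym (ℤₚ.+-identityˡ (sumMap f ys))
sumMap-++ f (x L.∷ xs) ys = trans (cong (_+_ (f x)) (sumMap-++ f xs ys)) (sym (ℤₚ.+-assoc (f x) _ _))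

sumMap-map : ∀ (f : B → ℤ) (g : A → B) xs → sumMap f (L.map g xs) ≡ sumMap (f ∘ g) xs
sumMap-map f g L.[]       = refl
sumMap-map f g (x L.∷ xs) = cong (_+_ (f (g x))) (sumMap-map f g xs)

sumMap-+ : ∀ (f g : A → ℤ) xs → sumMap (λ x → f x + g x) xs ≡ sumMap f xs + sumMap g xs
sumMap-+ f g L.[]       = refl
sumMap-+ f g (x L.∷ xs) rewrite sumMap-+ f g xs = interchange (f x) (g x) (sumMap f xs) (sumMap g xs)
  where
  interchange : ∀ a b c d → a + b + (c + d) ≡ a + c + (b + d)
  interchange = solve-∀

sumMap-cong : ∀ {f g : A → ℤ} → (∀ x → f x ≡ g x) → ∀ xs → sumMap f xs ≡ sumMap g xs
sumMap-cong f≗g L.[]       = refl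
sumMap-cong f≗g (x L.∷ xs) = cong₂ _+_ (f≗g x) (sumMap-cong f≗g xs)

sumMap-affine : ∀ c k (f : A → ℤ) xs → sumMap (λ x → c + k * f x) xs ≡ + length xs * c + k * sumMap f xs
sumMap-affine c k f L.[]       = base c k
  where
  base : ∀ c k → + 0 ≡ + 0 * c + k * + 0
  base = solve-∀
sumMap-affine c k f (x L.∷ xs) rewrite sumMap-affine c k f xs | ℤₚ.pos-+ 1 (length xs) =
  step c k (f x) (+ length xs) (sumMap f xs)
  where
  step : ∀ c k y l s → c + k * y + (l * c + k * s) ≡ (+ 1 + l) * c + k * (y + s)
  step = solve-∀

length-allSigns : ∀ n → length (allSigns n) ≡ 2 ^ n
length-allSigns zero    = refl
length-allSigns (suc n) rewrite Lₚ.length-++ (L.map (true ∷_) (allSigns n)) {L.map (false ∷_) (allSigns n)}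
  | Lₚ.length-map (true ∷_) (allSigns n) | Lₚ.length-map (false ∷_) (allSigns n) | length-allSigns n =
  cong (2 ^ n ℕ.+_) (sym (ℕₚ.+-identityʳ (2 ^ n)))

sumMap-allSigns-suc : ∀ (f : Vec Bool (suc n) → ℤ) →
  sumMap f (allSigns (suc n)) ≡ sumMap (λ s → f (true ∷ s) + f (false ∷ s)) (allSigns n)
sumMap-allSigns-suc {n} f = begin
  sumMap f (L.map (true ∷_) (allSigns n) L.++ L.map (false ∷_) (allSigns n))
    ≡⟨ sumMap-++ f (L.map (true ∷_) (allSigns n)) (L.map (false ∷_) (allSigns n)) ⟩
  sumMap f (L.map (true ∷_) (allSigns n)) + sumMap f (L.map (false ∷_) (allSigns n))
    ≡⟨ cong₂ _+_ (sumMap-map f (true ∷_) (allSigns n)) (sumMap-map f (false ∷_) (allSigns n)) ⟩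
  sumMap (f ∘ (true ∷_)) (allSigns n) + sumMap (f ∘ (false ∷_)) (allSigns n)
    ≡⟨ sumMap-+ (f ∘ (true ∷_)) (f ∘ (false ∷_)) (allSigns n) ⟨
  sumMap (λ s → f (true ∷ s) + f (false ∷ s)) (allSigns n)
    ∎
  where open ≡-Reasoning

sumMap-dot-signed² : ∀ N (u : Vec ℤ n) →
  sumMap (λ s → dot (signed N s) u * dot (signed N s) u) (allSigns n) ≡ + (2 ^ n) * (+ N * + N * dot u u)
sumMap-dot-signed² N []                = base (+ N)
  where
  base : ∀ N → + 0 * + 0 + + 0 ≡ + 1 * (N * N * + 0)
  base = solve-∀
sumMap-dot-signed² {suc n} N (u₀ ∷ u) = begin
  sumMap (λ s → X′ s * X′ s) (allSigns (suc n))
    ≡⟨ sumMap-allSigns-suc (λ s → X′ s * X′ s) ⟩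
  sumMap (λ s → X′ (true ∷ s) * X′ (true ∷ s) + X′ (false ∷ s) * X′ (false ∷ s)) (allSigns n)
    ≡⟨ sumMap-cong (λ s → parallelogram (+ N) u₀ (X s)) (allSigns n) ⟩
  sumMap (λ s → c + + 2 * (X s * X s)) (allSigns n)
    ≡⟨ sumMap-affine c (+ 2) (λ s → X s * X s) (allSigns n) ⟩
  + length (allSigns n) * c + + 2 * sumMap (λ s → X s * X s) (allSigns n)
    ≡⟨ cong₂ (λ l S → + l * c + + 2 * S) (length-allSigns n) (sumMap-dot-signed² N u) ⟩
  + (2 ^ n) * c + + 2 * (+ (2 ^ n) * (+ N * + N * dot u u))
    ≡⟨ collect (+ N) u₀ (dot u u) (+ (2 ^ n)) ⟩
  + 2 * + (2 ^ n) * (+ N * + N * (u₀ * u₀ + dot u u))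
    ≡⟨ cong (_* (+ N * + N * (u₀ * u₀ + dot u u))) (ℤₚ.pos-* 2 (2 ^ n)) ⟨
  + (2 ^ suc n) * (+ N * + N * (u₀ * u₀ + dot u u))
    ∎
  where
  open ≡-Reasoning
  X′ : Vec Bool (suc n) → ℤ
  X′ s = dot (signed N s) (u₀ ∷ u)
  X : Vec Bool n → ℤ
  X s = dot (signed N s) u
  c = + 2 * (+ N * + N) * (u₀ * u₀)
  parallelogram : ∀ N u₀ x → (N * u₀ + x) * (N * u₀ + x) + (- N * u₀ + x) * (- N * u₀ + x)
                            ≡ + 2 * (N * N) * (u₀ * u₀) + + 2 * (x * x)
  parallelogram = solve-∀
  collect : ∀ N u₀ d t → t * (+ 2 * (N * N) * (u₀ * u₀)) + + 2 * (t * (N * N * d))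
                       ≡ + 2 * t * (N * N * (u₀ * u₀ + d))
  collect = solve-∀

count : ∀ {P : Pred A 0ℓ} → Decidable P → List A → ℕ
count P? xs = length (filter P? xs)

markov : ∀ (g : A → ℤ) T xs → (∀ x → + 0 ≤ g x) → (T + + 1) * + count (λ x → T ℤₚ.<? g x) xs ≤ sumMap g xs
markov g T L.[]       g≥0 = ℤₚ.≤-reflexive (ℤₚ.*-zeroʳ (T + + 1))
markov g T (x L.∷ xs) g≥0 with T ℤₚ.<? g x
... | yes T<gx = subst (_≤ g x + sumMap g xs) (sym (split T (+ count (λ x → T ℤₚ.<? g x) xs)))
                   (ℤₚ.+-mono-≤ (ℤₚ.i<j⇒suc[i]≤j T<gx) (markov g T xs g≥0))
  where
  split : ∀ T b → (T + + 1) * (+ 1 + b) ≡ + 1 + T + (T + + 1) * b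
  split = solve-∀
... | no _     = subst (_≤ g x + sumMap g xs) (ℤₚ.+-identityˡ _) (ℤₚ.+-mono-≤ (g≥0 x) (markov g T xs g≥0))

markov-cancel : ∀ K M b {E} → + 0 ≤ E → (+ K * E + + 1) * + b ≤ + M * E → K ℕ.* b ℕ.≤ M
markov-cancel K M b {+ zero} _ h with ℕₚ.n≤0⇒n≡0 (ℤₚ.drop‿+≤+ (subst₂ _≤_ (degenerate (+ K) (+ b)) (ℤₚ.*-zeroʳ (+ M)) h))
  where
  degenerate : ∀ k b → (k * + 0 + + 1) * b ≡ b
  degenerate = solve-∀
... | refl = subst (ℕ._≤ M) (sym (ℕₚ.*-zeroʳ K)) ℕ.z≤n
markov-cancel K M b {E@(+ suc _)} _ h = ℤₚ.drop‿+≤+ (ℤₚ.*-cancelʳ-≤-pos (+ (K ℕ.* b)) (+ M) E (begin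
  + (K ℕ.* b) * E            ≤⟨ ℤₚ.i≤i+j (+ (K ℕ.* b) * E) (+ b) ⟩
  + (K ℕ.* b) * E + + b      ≡⟨ cong (λ x → x * E + + b) (ℤₚ.pos-* K b) ⟩
  + K * + b * E + + b        ≡⟨ regroup (+ K) (+ b) E ⟩
  (+ K * E + + 1) * + b      ≤⟨ h ⟩
  + M * E                    ∎))
  where
  open ℤₚ.≤-Reasoning
  regroup : ∀ k b e → k * b * e + b ≡ (k * e + + 1) * b
  regroup = solve-∀

LargeProjection : ℕ → ℕ → Vec ℤ n → Pred (Vec Bool n) 0ℓ
LargeProjection K N u s = + K * (+ N * + N * dot u u) < dot (signed N s) u * dot (signed N s) u

largeProjection? : ∀ K N (u : Vec ℤ n) → Decidable (LargeProjection K N u)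
largeProjection? K N u s = _ ℤₚ.<? _

K*count-largeProjection≤2^n : ∀ K N (u : Vec ℤ n) → K ℕ.* count (largeProjection? K N u) (allSigns n) ℕ.≤ 2 ^ n
K*count-largeProjection≤2^n {n} K N u = markov-cancel K (2 ^ n) _ (0≤* (0≤x*x (+ N)) (0≤dot-self u))
  (subst ((+ K * E + + 1) * + count (largeProjection? K N u) (allSigns n) ≤_) (sumMap-dot-signed² N u)
    (markov (λ s → dot (signed N s) u * dot (signed N s) u) (+ K * E) (allSigns n) (λ s → 0≤x*x (dot (signed N s) u))))
  where
  E = + N * + N * dot u u

count-∷ : ∀ {P : Pred A 0ℓ} (P? : Decidable P) x xs → count P? (x L.∷ xs) ≡ count P? L.[ x ] ℕ.+ count P? xs
count-∷ P? x xs with does (P? x)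
... | true  = refl
... | false = refl

length≤count-cover : ∀ {C B₁ B₂ : Pred A 0ℓ} (C? : Decidable C) (B₁? : Decidable B₁) (B₂? : Decidable B₂) →
  (∀ x → ¬ B₁ x → ¬ B₂ x → C x) → ∀ xs → length xs ℕ.≤ count C? xs ℕ.+ (count B₁? xs ℕ.+ count B₂? xs)
length≤count-cover C? B₁? B₂? cover L.[]       = ℕ.z≤n
length≤count-cover C? B₁? B₂? cover (x L.∷ xs) = begin
  1 ℕ.+ length xs
    ≤⟨ ℕₚ.+-mono-≤ covered (length≤count-cover C? B₁? B₂? cover xs) ⟩
  (count C? L.[ x ] ℕ.+ (count B₁? L.[ x ] ℕ.+ count B₂? L.[ x ])) ℕ.+ (count C? xs ℕ.+ (count B₁? xs ℕ.+ count B₂? xs))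
    ≡⟨ interchange (count C? L.[ x ]) (count B₁? L.[ x ]) (count B₂? L.[ x ]) (count C? xs) (count B₁? xs) (count B₂? xs) ⟩
  (count C? L.[ x ] ℕ.+ count C? xs) ℕ.+ ((count B₁? L.[ x ] ℕ.+ count B₁? xs) ℕ.+ (count B₂? L.[ x ] ℕ.+ count B₂? xs))
    ≡⟨ cong₂ ℕ._+_ (count-∷ C? x xs) (cong₂ ℕ._+_ (count-∷ B₁? x xs) (count-∷ B₂? x xs)) ⟨
  count C? (x L.∷ xs) ℕ.+ (count B₁? (x L.∷ xs) ℕ.+ count B₂? (x L.∷ xs))
    ∎
  where
  open ℕₚ.≤-Reasoning
  covered : 1 ℕ.≤ count C? L.[ x ] ℕ.+ (count B₁? L.[ x ] ℕ.+ count B₂? L.[ x ])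
  covered with C? x | B₁? x | B₂? x
  ... | yes _ | _     | _     = ℕ.s≤s ℕ.z≤n
  ... | no _  | yes _ | _     = ℕ.s≤s ℕ.z≤n
  ... | no _  | no _  | yes _ = ℕ.s≤s ℕ.z≤n
  ... | no ¬c | no ¬b₁ | no ¬b₂ = ⊥-elim (¬c (cover x ¬b₁ ¬b₂))
  interchange : ∀ c b₁ b₂ c′ b₁′ b₂′ → (c ℕ.+ (b₁ ℕ.+ b₂)) ℕ.+ (c′ ℕ.+ (b₁′ ℕ.+ b₂′)) ≡ (c ℕ.+ c′) ℕ.+ ((b₁ ℕ.+ b₁′) ℕ.+ (b₂ ℕ.+ b₂′))
  interchange = ℕ-solve-∀

toℚᵘ-toℚ : ∀ z → toℚᵘ (toℚ z) ≃ᵘ mkℚᵘ z 0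
toℚᵘ-toℚ z = ℚₚ.toℚᵘ-fromℚᵘ (mkℚᵘ z 0)

toℚᵘ-toℚ-* : ∀ x y → toℚᵘ (toℚ x ℚ.* toℚ y) ≃ᵘ mkℚᵘ x 0 ℚᵘ.* mkℚᵘ y 0
toℚᵘ-toℚ-* x y = ℚᵘₚ.≃-trans (ℚₚ.toℚᵘ-homo-* (toℚ x) (toℚ y)) (ℚᵘₚ.*-cong (toℚᵘ-toℚ x) (toℚᵘ-toℚ y))

≤-via-ℚᵘ : ∀ {p q : ℚ} (x y : ℚᵘ) → toℚᵘ p ≃ᵘ x → toℚᵘ q ≃ᵘ y →
           ℚᵘ.↥ x * ℚᵘ.↧ y ≤ ℚᵘ.↥ y * ℚᵘ.↧ x → p ℚ.≤ q
≤-via-ℚᵘ x y p≃x q≃y h =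
  ℚₚ.toℚᵘ-cancel-≤ (ℚᵘₚ.≤-respˡ-≃ (ℚᵘₚ.≃-sym p≃x) (ℚᵘₚ.≤-respʳ-≃ (ℚᵘₚ.≃-sym q≃y) (*≤* h)))

sq≤ε²*-from-ℤ : ∀ ε .{{_ : ℚ.Positive ε}} (D X Y : ℤ) → + 0 ≤ X * Y → ℚ.↧ ε * ℚ.↧ ε * (D * D) ≤ X * Y →
                toℚ D ℚ.* toℚ D ℚ.≤ (ε ℚ.* ε) ℚ.* (toℚ X ℚ.* toℚ Y)
sq≤ε²*-from-ℤ ε@(mkℚ +[1+ a ] d _) D X Y 0≤XY h = ≤-via-ℚᵘ
  (mkℚᵘ D 0 ℚᵘ.* mkℚᵘ D 0) ((toℚᵘ ε ℚᵘ.* toℚᵘ ε) ℚᵘ.* (mkℚᵘ X 0 ℚᵘ.* mkℚᵘ Y 0))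
  (toℚᵘ-toℚ-* D D)
  (ℚᵘₚ.≃-trans (ℚₚ.toℚᵘ-homo-* (ε ℚ.* ε) _) (ℚᵘₚ.*-cong (ℚₚ.toℚᵘ-homo-* ε ε) (toℚᵘ-toℚ-* X Y)))
  -- the chain runs from ↥ x * ↧ y to ↥ y * ↧ x, in the form these compute to
  (begin
    D * D * (+ suc d * + suc d * (+ 1 * + 1))         ≡⟨ rearrangeˡ D (+ suc d) ⟩
    + suc d * + suc d * (D * D)                       ≤⟨ h ⟩
    X * Y                                             ≤⟨ i≤k*i {+ suc a * + suc a} (ℤ.+≤+ (ℕ.s≤s ℕ.z≤n)) 0≤XY ⟩
    + suc a * + suc a * (X * Y)                       ≡⟨ rearrangeʳ (+ suc a) (X * Y) ⟩
    + suc a * + suc a * (X * Y) * (+ 1 * + 1)         ∎)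
  where
  open ℤₚ.≤-Reasoning
  rearrangeˡ : ∀ D m → D * D * (m * m * (+ 1 * + 1)) ≡ m * m * (D * D)
  rearrangeˡ = solve-∀
  rearrangeʳ : ∀ n z → n * n * z ≡ n * n * z * (+ 1 * + 1)
  rearrangeʳ = solve-∀

proportion-from-ℕ : ∀ ε .{{_ : ℚ.Positive ε}} (T c : ℕ) → ℚ.↧ₙ ε ℕ.* T ℕ.≤ ℚ.↧ₙ ε ℕ.* c ℕ.+ T →
                    (1ℚ ℚ.- ε) ℚ.* toℚ (+ T) ℚ.≤ toℚ (+ c)
proportion-from-ℕ ε@(mkℚ +[1+ a ] d _) T c h = ≤-via-ℚᵘ
  ((mkℚᵘ (+ 1) 0 ℚᵘ.+ ℚᵘ.- toℚᵘ ε) ℚᵘ.* mkℚᵘ (+ T) 0) (mkℚᵘ (+ c) 0)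
  (ℚᵘₚ.≃-trans (ℚₚ.toℚᵘ-homo-* (1ℚ ℚ.- ε) (toℚ (+ T)))
    (ℚᵘₚ.*-cong (ℚᵘₚ.≃-trans (ℚₚ.toℚᵘ-homo-+ 1ℚ (ℚ.- ε)) (ℚᵘₚ.+-congʳ (mkℚᵘ (+ 1) 0) (ℚₚ.toℚᵘ-homo‿- ε))) (toℚᵘ-toℚ (+ T))))
  (toℚᵘ-toℚ (+ c))
  (begin
    (+ 1 * den + - num * + 1) * + T * + 1   ≡⟨ expandˡ den num (+ T) ⟩
    den * + T - num * + T                   ≤⟨ ℤₚ.+-monoʳ-≤ (den * + T) (ℤₚ.neg-mono-≤ (i≤k*i {num} (ℤ.+≤+ (ℕ.s≤s ℕ.z≤n)) (ℤ.+≤+ ℕ.z≤n))) ⟩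
    den * + T - + T                         ≤⟨ ℤₚ.+-monoˡ-≤ (- + T) hℤ ⟩
    den * + c + + T - + T                   ≡⟨ expandʳ den (+ c) (+ T) ⟩
    + c * (+ 1 * den * + 1)                 ∎)
  where
  open ℤₚ.≤-Reasoning
  den = + suc d
  num = + suc a
  hℤ : den * + T ≤ den * + c + + T
  hℤ = subst₂ _≤_ (ℤₚ.pos-* (suc d) T) (trans (ℤₚ.pos-+ (suc d ℕ.* c) T) (cong (_+ + T) (ℤₚ.pos-* (suc d) c))) (ℤ.+≤+ h)
  expandˡ : ∀ m n t → (+ 1 * m + - n * + 1) * t * + 1 ≡ m * t - n * t
  expandˡ = solve-∀
  expandʳ : ∀ m c t → m * c + t - t ≡ c * (+ 1 * m * + 1)
  expandʳ = solve-∀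

cos²-bound : ∀ {m² K P n N² Qa Z X Y : ℤ} → + 0 ≤ m² → + 0 ≤ K → + 0 ≤ N² → + 0 ≤ Qa → + 0 ≤ P + + 1 →
  m² * K * (P * P) ≤ n * (P * P - (P + + 1) * K) →
  X * X ≤ K * (N² * Z) → Z ≤ P * P * Qa → Y * Y ≤ K * (N² * n) →
  m² * (X * X) ≤ Qa * (P * P * (n * N²) - (P + + 1) * (Y * Y))
cos²-bound {m²} {K} {P} {n} {N²} {Qa} {Z} {X} {Y} 0≤m² 0≤K 0≤N² 0≤Qa 0≤P+1 dimension X²≤ Z≤ Y²≤ = begin
  m² * (X * X)                                            ≤⟨ *-monoˡ-≤-nonNeg′ 0≤m² X²≤ ⟩
  m² * (K * (N² * Z))                                     ≤⟨ *-monoˡ-≤-nonNeg′ 0≤m² (*-monoˡ-≤-nonNeg′ 0≤K (*-monoˡ-≤-nonNeg′ 0≤N² Z≤)) ⟩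
  m² * (K * (N² * (P * P * Qa)))                          ≡⟨ regroupˡ m² K N² P Qa ⟩
  N² * Qa * (m² * K * (P * P))                            ≤⟨ *-monoˡ-≤-nonNeg′ (0≤* 0≤N² 0≤Qa) dimension ⟩
  N² * Qa * (n * (P * P - (P + + 1) * K))                 ≡⟨ regroupʳ N² Qa n P K ⟩
  Qa * (P * P * (n * N²) - (P + + 1) * (K * (N² * n)))    ≤⟨ *-monoˡ-≤-nonNeg′ 0≤Qa (ℤₚ.+-monoʳ-≤ (P * P * (n * N²)) (ℤₚ.neg-mono-≤ (*-monoˡ-≤-nonNeg′ 0≤P+1 Y²≤))) ⟩
  Qa * (P * P * (n * N²) - (P + + 1) * (Y * Y))           ∎
  where
  open ℤₚ.≤-Reasoning
  regroupˡ : ∀ m² K N² P Qa → m² * (K * (N² * (P * P * Qa))) ≡ N² * Qa * (m² * K * (P * P))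
  regroupˡ = solve-∀
  regroupʳ : ∀ N² Qa n P K → N² * Qa * (n * (P * P - (P + + 1) * K)) ≡ Qa * (P * P * (n * N²) - (P + + 1) * (K * (N² * n)))
  regroupʳ = solve-∀

dimensionBound : ℕ → ℕ
dimensionBound m = 2 ℕ.* (m ℕ.* m ℕ.* m) ℕ.+ 2 ℕ.* m

pos-dimensionBound+ : ∀ m t → + (dimensionBound m ℕ.+ t) ≡ + 2 * (+ m * + m * + m) + + 2 * + m + + t
pos-dimensionBound+ m t = begin
  + (dimensionBound m ℕ.+ t)                          ≡⟨ ℤₚ.pos-+ (dimensionBound m) t ⟩
  + dimensionBound m + + t                            ≡⟨ cong (_+ + t) (ℤₚ.pos-+ (2 ℕ.* m³) (2 ℕ.* m)) ⟩
  + (2 ℕ.* m³) + + (2 ℕ.* m) + + t                    ≡⟨ cong₂ (λ a b → a + b + + t) (ℤₚ.pos-* 2 m³) (ℤₚ.pos-* 2 m) ⟩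
  + 2 * + m³ + + 2 * + m + + t                        ≡⟨ cong (λ a → + 2 * a + + 2 * + m + + t) pos-m³ ⟩
  + 2 * (+ m * + m * + m) + + 2 * + m + + t           ∎
  where
  open ≡-Reasoning
  m³ = m ℕ.* m ℕ.* m
  pos-m³ : + m³ ≡ + m * + m * + m
  pos-m³ = trans (ℤₚ.pos-* (m ℕ.* m) m) (cong (_* + m) (ℤₚ.pos-* m m))

dimension-condition : ∀ m {n} → dimensionBound m ℕ.≤ n →
  + m * + m * + (2 ℕ.* m) * (+ suc n * + suc n) ≤ + n * (+ suc n * + suc n - (+ suc n + + 1) * + (2 ℕ.* m))
dimension-condition m {n} B≤n = excess-nonNeg (+ m) (+ (n ∸ dimensionBound m)) (ℤ.+≤+ ℕ.z≤n) (ℤ.+≤+ ℕ.z≤n)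
  (trans (cong +_ (sym (ℕₚ.m+[n∸m]≡n B≤n))) (pos-dimensionBound+ m (n ∸ dimensionBound m)))
  (ℤₚ.pos-+ 1 n) (ℤₚ.pos-* 2 m)
  where
  excess-nonNeg : ∀ m t {n P K} → + 0 ≤ m → + 0 ≤ t → n ≡ + 2 * (m * m * m) + + 2 * m + t → P ≡ + 1 + n → K ≡ + 2 * m →
    m * m * K * (P * P) ≤ n * (P * P - (P + + 1) * K)
  excess-nonNeg m t 0≤m 0≤t refl refl refl =
    subst (m * m * K * (P * P) ≤_) (sym (excess m t)) (ℤₚ.i≤i+j _ (t * (P * P) + K) {{ℤ.nonNegative 0≤excess}})
    where
    K = + 2 * m
    P = + 1 + (+ 2 * (m * m * m) + K + t)
    0≤excess : + 0 ≤ t * (P * P) + K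
    0≤excess = ℤₚ.+-mono-≤ (0≤* 0≤t (0≤x*x P)) (0≤* {+ 2} (ℤ.+≤+ ℕ.z≤n) 0≤m)
    excess : ∀ m t → let n = + 2 * (m * m * m) + + 2 * m + t ; P = + 1 + n in
      n * (P * P - (P + + 1) * (+ 2 * m)) ≡ m * m * (+ 2 * m) * (P * P) + (t * (P * P) + + 2 * m)
    excess = solve-∀

cosSmall-intro : ∀ ε .{{_ : ℚ.Positive ε}} (α β : Vec ℤ n) →
  ℚ.↧ ε * ℚ.↧ ε * (dot (ψ α) (ψ β) * dot (ψ α) (ψ β)) ≤ normSq α * normSq β → CosSmall ε α β
cosSmall-intro ε α β = sq≤ε²*-from-ℤ ε (dot (ψ α) (ψ β)) (normSq α) (normSq β) (0≤* (0≤dot-self (ψ α)) (0≤dot-self (ψ β)))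

cosSmall-if-projections-small : ∀ ε .{{_ : ℚ.Positive ε}} N {n} → dimensionBound (ℚ.↧ₙ ε) ℕ.≤ n →
  (α : Vec ℤ n) (s : Vec Bool n) → let K = 2 ℕ.* ℚ.↧ₙ ε in
  ¬ LargeProjection K N (ψ′ (ψ′ α)) s → ¬ LargeProjection K N (𝟙 n) s → CosSmall ε α (signed N s)
cosSmall-if-projections-small ε N {n} bound α s small₁ small₂ = cosSmall-intro ε α β
  (subst₂ (λ D Qb → ℚ.↧ ε * ℚ.↧ ε * (D * D) ≤ normSq α * Qb) (sym (dot-ψ-ψ α β)) (sym (normSq-signed N s))
    (cos²-bound {ℚ.↧ ε * ℚ.↧ ε} {+ K} {+ suc n} {+ n} {+ N * + N} {normSq α} {dot z z} {dot β z} {dot β (𝟙 n)}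
      (0≤x*x (ℚ.↧ ε)) (ℤ.+≤+ ℕ.z≤n) (0≤x*x (+ N)) (0≤dot-self (ψ α)) (ℤ.+≤+ ℕ.z≤n)
      (dimension-condition (ℚ.↧ₙ ε) bound)
      (ℤₚ.≮⇒≥ small₁)
      (subst (dot z z ≤_) (cong (+ suc n * + suc n *_) (sym (dot-ψ α α))) (dot-ψ′-ψ′≤ (ψ′ α)))
      (subst (λ d → dot β (𝟙 n) * dot β (𝟙 n) ≤ + K * (+ N * + N * d)) (dot-𝟙-𝟙 n) (ℤₚ.≮⇒≥ small₂))))
  where
  K = 2 ℕ.* ℚ.↧ₙ ε
  β = signed N s
  z = ψ′ (ψ′ α)

proportion-cosSmall : ∀ ε .{{_ : ℚ.Positive ε}} N {n} → dimensionBound (ℚ.↧ₙ ε) ℕ.≤ n → (α : Vec ℤ n) →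
  (1ℚ ℚ.- ε) ℚ.* toℚ (+ length (allSigns n)) ℚ.≤ toℚ (+ count (λ s → cosSmall? ε α (signed N s)) (allSigns n))
proportion-cosSmall ε N {n} bound α = proportion-from-ℕ ε total (count good? (allSigns n))
  (few-bad (length≤count-cover good? bad₁? bad₂? (cosSmall-if-projections-small ε N bound α) (allSigns n))
           (K*count≤total (ψ′ (ψ′ α))) (K*count≤total (𝟙 n)))
  where
  m = ℚ.↧ₙ ε
  K = 2 ℕ.* m
  total = length (allSigns n)
  good? = λ s → cosSmall? ε α (signed N s)
  bad₁? = largeProjection? K N (ψ′ (ψ′ α))
  bad₂? = largeProjection? K N (𝟙 n)
  K*count≤total : ∀ u → K ℕ.* count (largeProjection? K N u) (allSigns n) ℕ.≤ total
  K*count≤total u = subst (K ℕ.* count (largeProjection? K N u) (allSigns n) ℕ.≤_) (sym (length-allSigns n)) (K*count-largeProjection≤2^n K N u)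
  few-bad : ∀ {c b₁ b₂} → total ℕ.≤ c ℕ.+ (b₁ ℕ.+ b₂) → K ℕ.* b₁ ℕ.≤ total → K ℕ.* b₂ ℕ.≤ total → m ℕ.* total ℕ.≤ m ℕ.* c ℕ.+ total
  few-bad {c} {b₁} {b₂} cover bad₁ bad₂ = begin
    m ℕ.* total                      ≤⟨ ℕₚ.*-monoʳ-≤ m cover ⟩
    m ℕ.* (c ℕ.+ (b₁ ℕ.+ b₂))        ≡⟨ ℕₚ.*-distribˡ-+ m c (b₁ ℕ.+ b₂) ⟩
    m ℕ.* c ℕ.+ m ℕ.* (b₁ ℕ.+ b₂)    ≤⟨ ℕₚ.+-monoʳ-≤ (m ℕ.* c) (ℕₚ.*-cancelˡ-≤ 2 (begin
      2 ℕ.* (m ℕ.* (b₁ ℕ.+ b₂))        ≡⟨ distribute m b₁ b₂ ⟩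
      K ℕ.* b₁ ℕ.+ K ℕ.* b₂            ≤⟨ ℕₚ.+-mono-≤ bad₁ bad₂ ⟩
      total ℕ.+ total                  ≡⟨ cong (total ℕ.+_) (ℕₚ.+-identityʳ total) ⟨
      2 ℕ.* total                      ∎)) ⟩
    m ℕ.* c ℕ.+ total                ∎
    where
    open ℕₚ.≤-Reasoning
    distribute : ∀ m b₁ b₂ → 2 ℕ.* (m ℕ.* (b₁ ℕ.+ b₂)) ≡ 2 ℕ.* m ℕ.* b₁ ℕ.+ 2 ℕ.* m ℕ.* b₂
    distribute = ℕ-solve-∀

n∣n! : ∀ n .{{_ : ℕ.NonZero n}} → n ∣ n !
n∣n! (suc n) = m∣m*n (n !)

prime-above : ∀ B → ∃ λ q → Prime q × B ℕ.< q
prime-above B with factorise (suc (B !))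
... | record { factors = L.[] ; isFactorisation = B!+1≡1 } =
  ⊥-elim (ℕₚ.<⇒≢ (ℕₚ.1≤n! B) (sym (ℕₚ.suc-injective B!+1≡1)))
... | record { factors = q L.∷ _ ; isFactorisation = B!+1≡product ; factorsPrime = q-prime All.∷ _ } =
  q , q-prime , ℕₚ.≰⇒> λ q≤B → ¬prime[1] (subst Prime (∣1⇒≡1 (q∣1 q≤B)) q-prime)
  where
  q∣B!+1 : q ∣ B ! ℕ.+ 1
  q∣B!+1 = subst (q ∣_) (trans (sym B!+1≡product) (ℕₚ.+-comm 1 (B !))) (m∣m*n _)
  q∣1 : q ℕ.≤ B → q ∣ 1
  q∣1 q≤B = ∣m+n∣m⇒∣n q∣B!+1 (∣-trans (n∣n! q {{prime⇒nonZero q-prime}}) (m≤n⇒m!∣n! q≤B))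

f : ℕ → ℚ
f p = mkℚ (+ 1) (suc p) (1-coprimeTo (suc (suc p)))

f-bounds : (p : ℕ) → Prime p → 0ℚ ℚ.< f p × f p ℚ.≤ (+ 1 / 2)
f-bounds p _ = ℚ.*<* (ℤ.+<+ (ℕ.s≤s ℕ.z≤n)) , ℚ.*≤* (ℤ.+≤+ (ℕ.s≤s (ℕ.s≤s ℕ.z≤n)))

f→0 : (δ : ℚ) → 0ℚ ℚ.< δ → ∃ λ P → (p : ℕ) → Prime p → P ℕ.≤ p → ∣ f p ∣ ℚ.≤ δ
f→0 (mkℚ (+ 0)      _ _) (ℚ.*<* (ℤ.+<+ ()))
f→0 (mkℚ ℤ.-[1+ _ ] _ _) (ℚ.*<* ())
f→0 (mkℚ +[1+ a ]   d _) _ = d , λ p _ d≤p → ℚ.*≤* (begin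
  + 1 * + suc d              ≡⟨ ℤₚ.*-identityˡ (+ suc d) ⟩
  + suc d                    ≤⟨ ℤ.+≤+ (ℕ.s≤s (ℕₚ.m≤n⇒m≤1+n d≤p)) ⟩
  + suc (suc p)              ≤⟨ i≤k*i {+[1+ a ]} (ℤ.+≤+ (ℕ.s≤s ℕ.z≤n)) (ℤ.+≤+ ℕ.z≤n) ⟩
  +[1+ a ] * + suc (suc p)   ∎)
  where open ℤₚ.≤-Reasoning

theorem2 : (ε : ℚ) → 0ℚ ℚ.< ε →
    Σ ℕ λ pε → Prime pε × Σ (ℕ → ℚ) λ f →
      ((p : ℕ) → Prime p → 0ℚ ℚ.< f p × f p ℚ.≤ (+ 1 / 2)) ×
      ((δ : ℚ) → 0ℚ ℚ.< δ → ∃ λ P → (p : ℕ) → Prime p → P ℕ.≤ p → ∣ f p ∣ ℚ.≤ δ) ×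
      ((p : ℕ) → Prime p → 3 ℕ.≤ p → pε ℕ.≤ p →
        (N : ℕ) → 1 ℕ.≤ N →
        (α : Cyc p) → InBox p N α → DistGe p N (f p) α →
        (1ℚ ℚ.- ε) ℚ.* toℚ (+ cardV p) ℚ.≤ toℚ (+ goodCount p N ε α))
-- The count bound holds for every α.
theorem2 ε ε>0 = pε , pε-prime , f , f-bounds , f→0 ,
  λ p _ _ pε≤p N _ α _ _ → proportion-cosSmall ε {{ℚ.positive ε>0}} N (dimension≤p∸1 p pε≤p) α
  where
  n₀ = dimensionBound (ℚ.↧ₙ ε)
  pε = proj₁ (prime-above n₀)
  pε-prime = proj₁ (proj₂ (prime-above n₀))
  dimension≤p∸1 : ∀ p → pε ℕ.≤ p → n₀ ℕ.≤ p ∸ 1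
  dimension≤p∸1 p pε≤p =
    subst (n₀ ℕ.≤_) (ℕₚ.pred[m∸n]≡m∸[1+n] p 0) (ℕₚ.<⇒≤pred (ℕₚ.<-≤-trans (proj₂ (proj₂ (prime-above n₀))) pε≤p))
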